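{- Let $\lambda$ be a nonzero real number and let $m,n\ge 0$ be integers. Then \[ \phi_{m+n,\lambda}(x)=\sum_{j=0}^{m}\sum_{k=0}^{n}\binom{n}{k}{m \brace j}_{\lambda}(j-m\lambda)_{n-k,\lambda}\,x^{j}\,\phi_{k,\lambda}(x). \] In particular, setting $x=1$, \[ \phi_{m+n,\lambda}=\sum_{j=0}^{m}\sum_{k=0}^{n}\binom{n}{k}{m \brace j}_{\lambda}(j-m\lambda)_{n-k,\lambda}\,\phi_{k,\lambda}, \] where $\phi_{n,\lambda}=\phi_{n,\lambda}(1)$ are the degenerate Bell numbers.
   Context: For nonzero real $\lambda$, the degenerate falling factorial is $(x)_{0,\lambda}=1$, $(x)_{n,\lambda}=x(x-\lambda)(x-2\lambda)\cdots(x-(n-1)\lambda)$ for $n\ge1$. The degenerate exponentials are the formal power series $e_\lambda^{x}(t)=\sum_{n\ge0}(x)_{n,\lambda}\frac{t^n}{n!}$ and $e_\lambda(t)=e_\lambda^{1}(t)$. The degenerate Stirling numbers of the second kind ${n\brace k}_\lambda$ are defined by $(x)_{n,\lambda}=\sum_{k=0}^n {n\brace k}_\lambda (x)_k$, with $(x)_k=x(x-1)\cdots(x-k+1)$, $(x)_0=1$. The degenerate Bell polynomials $\phi_{n,\lambda}(x)$ are defined by $e^{x(e_\lambda(t)-1)}=\sum_{n\ge0}\phi_{n,\lambda}(x)\frac{t^n}{n!}$; equivalently $\phi_{n,\lambda}(x)=\sum_{k=0}^n {n\brace k}_\lambda x^k$. -}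

module Defs where

open import Algebra.Bundles using (CommutativeRing)
open import Data.Nat using (ℕ; zero; suc; _∸_)
open import Data.Nat.Combinatorics using (_C_)

-- Degenerate Stirling/Bell machinery over an arbitrary commutative ring R
-- (the paper works over ℝ).
module Degenerate {c ℓ} (R : CommutativeRing c ℓ) where
  open CommutativeRing R hiding (zero)

  nat : ℕ → Carrier
  nat zero    = 0#
  nat (suc n) = 1# + nat n

  sumTo : ℕ → (ℕ → Carrier) → Carrier
  sumTo zero    f = f zero
  sumTo (suc n) f = sumTo n f + f (suc n)

  pow : Carrier → ℕ → Carrier
  pow x zero    = 1#
  pow x (suc n) = pow x n * x

  dfall : (lam : Carrier) → Carrier → ℕ → Carrier
  dfall lam x zero    = 1#
  dfall lam x (suc n) = dfall lam x n * (x - nat n * lam)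

  -- degenerate Stirling numbers of the second kind {n brace k}_λ,
  -- i.e. the coefficients in (x)_{n,λ} = Σ_k {n brace k}_λ (x)_k, computed by
  -- the recurrence obtained from (x)_{n+1,λ} = (x)_{n,λ}(x - nλ):
  --   {n+1 brace k}_λ = {n brace k-1}_λ + (k - nλ){n brace k}_λ
  S : (lam : Carrier) → ℕ → ℕ → Carrier
  S lam zero    zero    = 1#
  S lam zero    (suc k) = 0#
  S lam (suc n) zero    = (0# - nat n * lam) * S lam n zero
  S lam (suc n) (suc k) = S lam n k + (nat (suc k) - nat n * lam) * S lam n (suc k)

  φ : (lam : Carrier) → ℕ → Carrier → Carrier
  φ lam n x = sumTo n (λ k → S lam n k * pow x k)

  rhs : (lam : Carrier) → ℕ → ℕ → Carrier → Carrier
  rhs lam m n x =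
    sumTo m (λ j → sumTo n (λ k →
      nat (n C k) * S lam m j * dfall lam (nat j - nat m * lam) (n ∸ k)
        * pow x j * φ lam k x))

-- Let L be the linear map (y)_k ↦ x^k on polynomials in y, so that φ_{n,λ}(x) = L((y)_{n,λ}).
-- Factor (y)_{m+n,λ} = (y)_{m,λ} (y - mλ)_{n,λ} and expand (y)_{m,λ} = Σ_j {m brace j}_λ (y)_j.
-- Writing y - mλ = (y - j) + (j - mλ), the degenerate binomial theorem gives
--   (y)_j (y - mλ)_{n,λ} = Σ_k C(n,k) (j - mλ)_{n-k,λ} (y)_j (y - j)_{k,λ},
-- and since (y)_j (y - j)_l = (y)_{j+l}, L((y)_j (y - j)_{k,λ}) = x^j φ_{k,λ}(x).
module Submission where

open import Algebra.Bundles using (CommutativeRing)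
import Algebra.Properties.AbelianGroup as AbelianGroupProperties
import Algebra.Properties.CommutativeSemigroup as CommutativeSemigroupProperties
import Algebra.Solver.Ring.NaturalCoefficients.Default as NaturalCoefficientsSolver
open import Data.Nat
  using (ℕ; zero; suc; _∸_; _≤_; _<_; _≤′_; ≤′-refl; ≤′-step; z≤n; s≤s; _≤?_)
  renaming (_+_ to _+ℕ_)
import Data.Nat.Properties as ℕ
open import Data.Nat.Combinatorics using (_C_; k>n⇒nCk≡0; nCk+nC[k+1]≡[n+1]C[k+1])
open import Data.Product using (_×_; _,_)
open import Data.Sum using (inj₁; inj₂)
open import Function using (_∘_)
open import Relation.Nullary using (¬_; yes; no; contradiction)
import Relation.Binary.PropositionalEquality as ≡
open ≡ using (_≢_)
open import Defs

module _ {r ℓ} (R : CommutativeRing r ℓ) where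
  open CommutativeRing R hiding (zero)
  open Degenerate R
  open AbelianGroupProperties +-abelianGroup using (⁻¹-anti-homo‿-)
  module +-Props = CommutativeSemigroupProperties +-commutativeSemigroup
  module *-Props = CommutativeSemigroupProperties *-commutativeSemigroup
  open NaturalCoefficientsSolver commutativeSemiring using (solve; _:=_; _:+_; _:*_)
  open import Relation.Binary.Reasoning.Setoid setoid

  [x-y]+[y-z]≈x-z : ∀ x y z → (x - y) + (y - z) ≈ x - z
  [x-y]+[y-z]≈x-z x y z = begin
    (x - y) + (y - z)   ≈⟨ +-assoc x (- y) (y - z) ⟩
    x + (- y + (y - z)) ≈⟨ +-congˡ (+-assoc (- y) y (- z)) ⟨
    x + ((- y + y) - z) ≈⟨ +-congˡ (+-congʳ (-‿inverseˡ y)) ⟩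
    x + (0# - z)        ≈⟨ +-congˡ (+-identityˡ (- z)) ⟩
    x - z               ∎

  [x+y]-z≈y-[z-x] : ∀ x y z → (x + y) - z ≈ y - (z - x)
  [x+y]-z≈y-[z-x] x y z = begin
    (x + y) - z ≈⟨ +-congʳ (+-comm x y) ⟩
    (y + x) - z ≈⟨ +-assoc y x (- z) ⟩
    y + (x - z) ≈⟨ +-congˡ (⁻¹-anti-homo‿- z x) ⟨
    y - (z - x) ∎

  x-[x-y]≈y : ∀ x y → x - (x - y) ≈ y
  x-[x-y]≈y x y = begin
    x - (x - y) ≈⟨ +-congˡ (⁻¹-anti-homo‿- x y) ⟩
    x + (y - x) ≈⟨ +-Props.x∙yz≈y∙xz x y (- x) ⟩
    y + (x - x) ≈⟨ +-congˡ (-‿inverseʳ x) ⟩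
    y + 0#      ≈⟨ +-identityʳ y ⟩
    y           ∎

  nat-+ : ∀ m n → nat (m +ℕ n) ≈ nat m + nat n
  nat-+ zero    n = sym (+-identityˡ (nat n))
  nat-+ (suc m) n = trans (+-congˡ (nat-+ m n)) (sym (+-assoc 1# (nat m) (nat n)))

  nat-+-* : ∀ m n a → nat (m +ℕ n) * a ≈ nat m * a + nat n * a
  nat-+-* m n a = trans (*-congʳ (nat-+ m n)) (distribʳ a (nat m) (nat n))

  pow-+ : ∀ x m n → pow x (m +ℕ n) ≈ pow x m * pow x n
  pow-+ x zero    n = sym (*-identityˡ (pow x n))
  pow-+ x (suc m) n = trans (*-congʳ (pow-+ x m n)) (*-Props.xy∙z≈xz∙y (pow x m) (pow x n) x)

  sumTo-cong≤ : ∀ n {f g : ℕ → Carrier} → (∀ {i} → i ≤ n → f i ≈ g i) →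
                sumTo n f ≈ sumTo n g
  sumTo-cong≤ zero    f≈g = f≈g z≤n
  sumTo-cong≤ (suc n) f≈g = +-cong (sumTo-cong≤ n (f≈g ∘ ℕ.m≤n⇒m≤1+n)) (f≈g ℕ.≤-refl)

  sumTo-cong : ∀ n {f g : ℕ → Carrier} → (∀ i → f i ≈ g i) → sumTo n f ≈ sumTo n g
  sumTo-cong n f≈g = sumTo-cong≤ n (λ {i} _ → f≈g i)

  sumTo-distrib-+ : ∀ n (f g : ℕ → Carrier) → sumTo n (λ i → f i + g i) ≈ sumTo n f + sumTo n g
  sumTo-distrib-+ zero    f g = refl
  sumTo-distrib-+ (suc n) f g = trans (+-congʳ (sumTo-distrib-+ n f g)) (+-Props.interchange _ _ _ _)

  *-distribˡ-sumTo : ∀ n a (f : ℕ → Carrier) → a * sumTo n f ≈ sumTo n (λ i → a * f i)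
  *-distribˡ-sumTo zero    a f = refl
  *-distribˡ-sumTo (suc n) a f = trans (distribˡ a _ _) (+-congʳ (*-distribˡ-sumTo n a f))

  *-distribʳ-sumTo : ∀ n a (f : ℕ → Carrier) → sumTo n f * a ≈ sumTo n (λ i → f i * a)
  *-distribʳ-sumTo zero    a f = refl
  *-distribʳ-sumTo (suc n) a f = trans (distribʳ a _ _) (+-congʳ (*-distribʳ-sumTo n a f))

  sumTo-comm : ∀ m n (f : ℕ → ℕ → Carrier) →
               sumTo m (λ j → sumTo n (f j)) ≈ sumTo n (λ k → sumTo m (λ j → f j k))
  sumTo-comm zero    n f = refl
  sumTo-comm (suc m) n f = trans (+-congʳ (sumTo-comm m n f)) (sym (sumTo-distrib-+ n _ _))

  sumTo-sucˡ : ∀ n (f : ℕ → Carrier) → sumTo (suc n) f ≈ f 0 + sumTo n (f ∘ suc)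
  sumTo-sucˡ zero    f = refl
  sumTo-sucˡ (suc n) f = trans (+-congʳ (sumTo-sucˡ n f)) (+-assoc _ _ _)

  sumTo-vanishingˡ : ∀ j n {f : ℕ → Carrier} → (∀ {l} → l < j → f l ≈ 0#) →
                     sumTo (j +ℕ n) f ≈ sumTo n (λ l → f (j +ℕ l))
  sumTo-vanishingˡ zero    n f≈0 = refl
  sumTo-vanishingˡ (suc j) n {f} f≈0 = begin
    sumTo (suc (j +ℕ n)) f
      ≈⟨ sumTo-sucˡ (j +ℕ n) f ⟩
    f 0 + sumTo (j +ℕ n) (f ∘ suc)
      ≈⟨ +-cong (f≈0 (s≤s z≤n)) (sumTo-vanishingˡ j n (f≈0 ∘ s≤s)) ⟩
    0# + sumTo n (λ l → f (suc j +ℕ l))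
      ≈⟨ +-identityˡ _ ⟩
    sumTo n (λ l → f (suc j +ℕ l))
      ∎

  sumTo-vanishingʳ : ∀ {d N} {f : ℕ → Carrier} → (∀ {l} → d < l → f l ≈ 0#) → d ≤ N →
                     sumTo N f ≈ sumTo d f
  sumTo-vanishingʳ {d} {f = f} f≈0 d≤N = go (ℕ.≤⇒≤′ d≤N)
    where
    go : ∀ {N} → d ≤′ N → sumTo N f ≈ sumTo d f
    go ≤′-refl        = refl
    go (≤′-step d≤′N) =
      trans (+-cong (go d≤′N) (f≈0 (s≤s (ℕ.≤′⇒≤ d≤′N)))) (+-identityʳ _)

  sumTo-pascal : ∀ n (f : ℕ → Carrier) →
                 sumTo (suc n) (λ i → nat (suc n C i) * f i)
                 ≈ sumTo n (λ i → nat (n C i) * f (suc i)) + sumTo n (λ i → nat (n C i) * f i)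
  sumTo-pascal n f = begin
    sumTo (suc n) (λ i → nat (suc n C i) * f i)
      ≈⟨ sumTo-sucˡ n _ ⟩
    g 0 + sumTo n (λ i → nat (suc n C suc i) * f (suc i))
      ≈⟨ +-congˡ (sumTo-cong n (λ i → trans (*-congʳ (pascal i)) (distribʳ (f (suc i)) _ _))) ⟩
    g 0 + sumTo n (λ i → nat (n C i) * f (suc i) + g (suc i))
      ≈⟨ +-congˡ (sumTo-distrib-+ n _ _) ⟩
    g 0 + (sumTo n (λ i → nat (n C i) * f (suc i)) + sumTo n (g ∘ suc))
      ≈⟨ +-Props.x∙yz≈y∙xz _ _ _ ⟩
    sumTo n (λ i → nat (n C i) * f (suc i)) + (g 0 + sumTo n (g ∘ suc))
      ≈⟨ +-congˡ (sumTo-sucˡ n g) ⟨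
    sumTo n (λ i → nat (n C i) * f (suc i)) + sumTo (suc n) g
      ≈⟨ +-congˡ (trans (+-congˡ top-vanishes) (+-identityʳ _)) ⟩
    sumTo n (λ i → nat (n C i) * f (suc i)) + sumTo n g
      ∎
    where
    g : ℕ → Carrier
    g i = nat (n C i) * f i
    pascal : ∀ i → nat (suc n C suc i) ≈ nat (n C i) + nat (n C suc i)
    pascal i = trans (reflexive (≡.cong nat (≡.sym (nCk+nC[k+1]≡[n+1]C[k+1] n i))))
                     (nat-+ (n C i) (n C suc i))
    top-vanishes : g (suc n) ≈ 0#
    top-vanishes = trans (*-congʳ (reflexive (≡.cong nat (k>n⇒nCk≡0 (ℕ.n<1+n n))))) (zeroˡ _)

  -- A coefficient sequence c stands for the polynomial Σ_l c l (y)_l.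
  Coeffs : Set r
  Coeffs = ℕ → Carrier

  infix 4 _≋_
  _≋_ : Coeffs → Coeffs → Set ℓ
  c ≋ d = ∀ l → c l ≈ d l

  combination : ℕ → (ℕ → Carrier) → (ℕ → Coeffs) → Coeffs
  combination m w c l = sumTo m (λ j → w j * c j l)

  prev : Coeffs → Coeffs
  prev c zero    = 0#
  prev c (suc l) = c l

  -- Multiplication by y - b, since y (y)_l = (y)_{l+1} + l (y)_l.
  mulRoot : Carrier → Coeffs → Coeffs
  mulRoot b c l = prev c l + (nat l - b) * c l

  mulRoots : Coeffs → (ℕ → Carrier) → ℕ → Coeffs
  mulRoots c b zero    = c
  mulRoots c b (suc n) = mulRoot (b n) (mulRoots c b n)

  unit : ℕ → Coeffs
  unit zero    zero    = 1#
  unit zero    (suc l) = 0#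
  unit (suc j) zero    = 0#
  unit (suc j) (suc l) = unit j l

  prev-cong : ∀ {c d} → c ≋ d → prev c ≋ prev d
  prev-cong c≋d zero    = refl
  prev-cong c≋d (suc l) = c≋d l

  mulRoot-cong : ∀ {b b′ c d} → b ≈ b′ → c ≋ d → mulRoot b c ≋ mulRoot b′ d
  mulRoot-cong b≈b′ c≋d l = +-cong (prev-cong c≋d l) (*-cong (+-congˡ (-‿cong b≈b′)) (c≋d l))

  mulRoots-cong : ∀ {c d b b′} → c ≋ d → (∀ t → b t ≈ b′ t) →
                  ∀ n → mulRoots c b n ≋ mulRoots d b′ n
  mulRoots-cong c≋d b≈b′ zero    = c≋d
  mulRoots-cong c≋d b≈b′ (suc n) = mulRoot-cong (b≈b′ n) (mulRoots-cong c≋d b≈b′ n)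

  prev-combination : ∀ m w c → prev (combination m w c) ≋ combination m w (prev ∘ c)
  prev-combination m w c zero    = trans (sym (zeroʳ (sumTo m w))) (*-distribʳ-sumTo m 0# w)
  prev-combination m w c (suc l) = refl

  mulRoot-combination : ∀ m w c b → mulRoot b (combination m w c) ≋ combination m w (mulRoot b ∘ c)
  mulRoot-combination m w c b l = begin
    prev (combination m w c) l + k * combination m w c l
      ≈⟨ +-cong (prev-combination m w c l) (*-distribˡ-sumTo m k _) ⟩
    sumTo m (λ j → w j * prev (c j) l) + sumTo m (λ j → k * (w j * c j l))
      ≈⟨ sumTo-distrib-+ m _ _ ⟨
    sumTo m (λ j → w j * prev (c j) l + k * (w j * c j l))
      ≈⟨ sumTo-cong m (λ j → +-congˡ (*-Props.x∙yz≈y∙xz k (w j) (c j l))) ⟩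
    sumTo m (λ j → w j * prev (c j) l + w j * (k * c j l))
      ≈⟨ sumTo-cong m (λ j → distribˡ (w j) _ _) ⟨
    combination m w (mulRoot b ∘ c) l
      ∎
    where
    k : Carrier
    k = nat l - b

  mulRoots-combination : ∀ m w c b n →
                         mulRoots (combination m w c) b n ≋ combination m w (λ j → mulRoots (c j) b n)
  mulRoots-combination m w c b zero    l = refl
  mulRoots-combination m w c b (suc n) l =
    trans (mulRoot-cong refl (mulRoots-combination m w c b n) l) (mulRoot-combination m w _ (b n) l)

  mulRoot-changeRoot : ∀ b b′ c → mulRoot b c ≋ λ l → mulRoot b′ c l + (b′ - b) * c l
  mulRoot-changeRoot b b′ c l = begin
    prev c l + (nat l - b) * c l
      ≈⟨ +-congˡ (*-congʳ ([x-y]+[y-z]≈x-z (nat l) b′ b)) ⟨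
    prev c l + ((nat l - b′) + (b′ - b)) * c l
      ≈⟨ +-congˡ (distribʳ (c l) _ _) ⟩
    prev c l + ((nat l - b′) * c l + (b′ - b) * c l)
      ≈⟨ +-assoc _ _ _ ⟨
    mulRoot b′ c l + (b′ - b) * c l
      ∎

  -- Since (y)_j (y - j)_l = (y)_{j+l}, Shifted j c′ c says that c′ stands for (y)_j p(y - j)
  -- when c stands for p.
  record Shifted (j : ℕ) (c′ c : Coeffs) : Set ℓ where
    field
      vanishes-below : ∀ {l} → l < j → c′ l ≈ 0#
      shifted        : ∀ l → c′ (j +ℕ l) ≈ c l

  Shifted-congʳ : ∀ {j c′ c d} → c ≋ d → Shifted j c′ c → Shifted j c′ d
  Shifted-congʳ c≋d sh = record
    { vanishes-below = vanishes-below
    ; shifted        = λ l → trans (shifted l) (c≋d l)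
    }
    where open Shifted sh

  prev-vanishes : ∀ {j c} → (∀ {l} → l < j → c l ≈ 0#) → ∀ {l} → l ≤ j → prev c l ≈ 0#
  prev-vanishes c≈0 {zero}  _   = refl
  prev-vanishes c≈0 {suc l} l<j = c≈0 l<j

  prev-shifted : ∀ {j c′ c} → Shifted j c′ c → Shifted j (prev c′) (prev c)
  prev-shifted {j} {c′} {c} sh = record
    { vanishes-below = prev-vanishes vanishes-below ∘ ℕ.<⇒≤
    ; shifted        = at
    }
    where
    open Shifted sh
    at : ∀ l → prev c′ (j +ℕ l) ≈ prev c l
    at zero    = trans (reflexive (≡.cong (prev c′) (ℕ.+-identityʳ j)))
                       (prev-vanishes vanishes-below ℕ.≤-refl)
    at (suc l) = trans (reflexive (≡.cong (prev c′) (ℕ.+-suc j l))) (shifted l)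

  mulRoot-shifted : ∀ {j c′ c} b → Shifted j c′ c →
                    Shifted j (mulRoot b c′) (mulRoot (b - nat j) c)
  mulRoot-shifted {j} b sh = record
    { vanishes-below = λ l<j → trans (+-cong (prev.vanishes-below l<j)
                                             (trans (*-congˡ (vanishes-below l<j)) (zeroʳ _)))
                                     (+-identityʳ 0#)
    ; shifted        = λ l → +-cong (prev.shifted l) (*-cong (root l) (shifted l))
    }
    where
    open Shifted sh
    module prev = Shifted (prev-shifted sh)
    root : ∀ l → nat (j +ℕ l) - b ≈ nat l - (b - nat j)
    root l = trans (+-congʳ (nat-+ j l)) ([x+y]-z≈y-[z-x] (nat j) (nat l) b)

  mulRoots-shifted : ∀ {j c′ c} b n → Shifted j c′ c →
                     Shifted j (mulRoots c′ b n) (mulRoots c (λ t → b t - nat j) n)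
  mulRoots-shifted b zero    sh = sh
  mulRoots-shifted b (suc n) sh = mulRoot-shifted (b n) (mulRoots-shifted b n sh)

  unit-diagonal : ∀ j → unit j j ≈ 1#
  unit-diagonal zero    = refl
  unit-diagonal (suc j) = unit-diagonal j

  unit-offDiagonal : ∀ {j l} → j ≢ l → unit j l ≈ 0#
  unit-offDiagonal {zero}  {zero}  j≢l = contradiction ≡.refl j≢l
  unit-offDiagonal {zero}  {suc l} _   = refl
  unit-offDiagonal {suc j} {zero}  _   = refl
  unit-offDiagonal {suc j} {suc l} j≢l = unit-offDiagonal (j≢l ∘ ≡.cong suc)

  unit-shifted : ∀ j → Shifted j (unit j) (unit 0)
  unit-shifted j = record { vanishes-below = unit-offDiagonal ∘ ℕ.>⇒≢ ; shifted = at j }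
    where
    at : ∀ i l → unit i (i +ℕ l) ≈ unit 0 l
    at zero    l = refl
    at (suc i) l = at i l

  combination-unit-> : ∀ m (f : ℕ → Carrier) {l} → m < l → combination m f unit l ≈ 0#
  combination-unit-> zero    f m<l = trans (*-congˡ (unit-offDiagonal (ℕ.<⇒≢ m<l))) (zeroʳ _)
  combination-unit-> (suc m) f {l} m<l = begin
    combination m f unit l + f (suc m) * unit (suc m) l
      ≈⟨ +-cong (combination-unit-> m f (ℕ.<-trans (ℕ.n<1+n m) m<l))
                (trans (*-congˡ (unit-offDiagonal (ℕ.<⇒≢ m<l))) (zeroʳ _)) ⟩
    0# + 0#
      ≈⟨ +-identityʳ 0# ⟩
    0# ∎

  combination-unit-≤ : ∀ m (f : ℕ → Carrier) {l} → l ≤ m → combination m f unit l ≈ f l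
  combination-unit-≤ zero    f z≤n = *-identityʳ (f 0)
  combination-unit-≤ (suc m) f {l} l≤1+m with ℕ.m≤n⇒m<n∨m≡n l≤1+m
  ... | inj₁ l<1+m = begin
    combination m f unit l + f (suc m) * unit (suc m) l
      ≈⟨ +-cong (combination-unit-≤ m f (ℕ.≤-pred l<1+m))
                (trans (*-congˡ (unit-offDiagonal (ℕ.>⇒≢ l<1+m))) (zeroʳ _)) ⟩
    f l + 0#
      ≈⟨ +-identityʳ (f l) ⟩
    f l ∎
  ... | inj₂ ≡.refl = begin
    combination m f unit l + f l * unit l l
      ≈⟨ +-cong (combination-unit-> m f (ℕ.n<1+n m))
                (trans (*-congˡ (unit-diagonal l)) (*-identityʳ (f l))) ⟩
    0# + f l
      ≈⟨ +-identityˡ (f l) ⟩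
    f l ∎

  combination-unit : ∀ m {c} → (∀ {l} → m < l → c l ≈ 0#) → c ≋ combination m c unit
  combination-unit m {c} c≈0 l with l ≤? m
  ... | yes l≤m = sym (combination-unit-≤ m c l≤m)
  ... | no  l≰m = trans (c≈0 (ℕ.≰⇒> l≰m)) (sym (combination-unit-> m c (ℕ.≰⇒> l≰m)))

  -- The map L of the header on polynomials of degree at most N.
  eval : ℕ → Coeffs → Carrier → Carrier
  eval N c x = sumTo N (λ l → c l * pow x l)

  eval-cong : ∀ N {c d} x → c ≋ d → eval N c x ≈ eval N d x
  eval-cong N x c≋d = sumTo-cong N (λ l → *-congʳ (c≋d l))

  eval-combination : ∀ N m w c x →
                     eval N (combination m w c) x ≈ sumTo m (λ j → w j * eval N (c j) x)
  eval-combination N m w c x = begin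
    sumTo N (λ l → combination m w c l * pow x l)
      ≈⟨ sumTo-cong N (λ l → *-distribʳ-sumTo m (pow x l) _) ⟩
    sumTo N (λ l → sumTo m (λ j → w j * c j l * pow x l))
      ≈⟨ sumTo-comm m N _ ⟨
    sumTo m (λ j → sumTo N (λ l → w j * c j l * pow x l))
      ≈⟨ sumTo-cong m (λ j → sumTo-cong N (λ l → *-assoc (w j) (c j l) (pow x l))) ⟩
    sumTo m (λ j → sumTo N (λ l → w j * (c j l * pow x l)))
      ≈⟨ sumTo-cong m (λ j → *-distribˡ-sumTo N (w j) _) ⟨
    sumTo m (λ j → w j * eval N (c j) x)
      ∎

  eval-shifted : ∀ {j c′ c} N x → Shifted j c′ c → eval (j +ℕ N) c′ x ≈ pow x j * eval N c x
  eval-shifted {j} {c′} {c} N x sh = begin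
    sumTo (j +ℕ N) (λ l → c′ l * pow x l)
      ≈⟨ sumTo-vanishingˡ j N (λ l<j → trans (*-congʳ (vanishes-below l<j)) (zeroˡ _)) ⟩
    sumTo N (λ l → c′ (j +ℕ l) * pow x (j +ℕ l))
      ≈⟨ sumTo-cong N (λ l → *-cong (shifted l) (pow-+ x j l)) ⟩
    sumTo N (λ l → c l * (pow x j * pow x l))
      ≈⟨ sumTo-cong N (λ l → *-Props.x∙yz≈y∙xz (c l) (pow x j) (pow x l)) ⟩
    sumTo N (λ l → pow x j * (c l * pow x l))
      ≈⟨ *-distribˡ-sumTo N (pow x j) _ ⟨
    pow x j * eval N c x
      ∎
    where open Shifted sh

  eval-vanishingʳ : ∀ {d N c} x → (∀ {l} → d < l → c l ≈ 0#) → d ≤ N →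
                    eval N c x ≈ eval d c x
  eval-vanishingʳ x c≈0 = sumTo-vanishingʳ (λ d<l → trans (*-congʳ (c≈0 d<l)) (zeroˡ _))

  module _ (lam : Carrier) where

    S-zero : S lam 0 ≋ unit 0
    S-zero zero    = refl
    S-zero (suc l) = refl

    S-suc : ∀ n → S lam (suc n) ≋ mulRoot (nat n * lam) (S lam n)
    S-suc n zero    = sym (+-identityˡ _)
    S-suc n (suc k) = refl

    S-vanishes : ∀ {n l} → n < l → S lam n l ≈ 0#
    S-vanishes {zero}  {suc l} _         = refl
    S-vanishes {suc n} {suc l} (s≤s n<l) = begin
      S lam n l + (nat (suc l) - nat n * lam) * S lam n (suc l)
        ≈⟨ +-cong (S-vanishes n<l) (trans (*-congˡ (S-vanishes (ℕ.m<n⇒m<1+n n<l))) (zeroʳ _)) ⟩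
      0# + 0#
        ≈⟨ +-identityʳ 0# ⟩
      0# ∎

    -- (y)_{m+n,λ} = (y)_{m,λ} (y - mλ)_{n,λ}
    S-+ : ∀ m n → S lam (m +ℕ n) ≋ mulRoots (S lam m) (λ t → nat (m +ℕ t) * lam) n
    S-+ m zero    l = reflexive (≡.cong (λ k → S lam k l) (ℕ.+-identityʳ m))
    S-+ m (suc n) l = begin
      S lam (m +ℕ suc n) l                            ≡⟨ ≡.cong (λ k → S lam k l) (ℕ.+-suc m n) ⟩
      S lam (suc (m +ℕ n)) l                          ≈⟨ S-suc (m +ℕ n) l ⟩
      mulRoot (nat (m +ℕ n) * lam) (S lam (m +ℕ n)) l ≈⟨ mulRoot-cong refl (S-+ m n) l ⟩
      mulRoots (S lam m) (λ t → nat (m +ℕ t) * lam) (suc n) l ∎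

    mulRoot-S : ∀ a {i n} → i ≤ n →
                mulRoot (nat n * lam - a) (S lam i)
                ≋ λ l → S lam (suc i) l + (a - nat (n ∸ i) * lam) * S lam i l
    mulRoot-S a {i} {n} i≤n l = begin
      mulRoot (nat n * lam - a) (S lam i) l
        ≈⟨ mulRoot-changeRoot _ (nat i * lam) (S lam i) l ⟩
      mulRoot (nat i * lam) (S lam i) l + (nat i * lam - (nat n * lam - a)) * S lam i l
        ≈⟨ +-cong (sym (S-suc i l)) (*-congʳ root) ⟩
      S lam (suc i) l + (a - nat (n ∸ i) * lam) * S lam i l
        ∎
      where
      u v : Carrier
      u = nat i * lam
      v = nat (n ∸ i) * lam
      split : nat n * lam ≈ v + u
      split = trans (*-congʳ (reflexive (≡.cong nat (≡.sym (ℕ.m∸n+n≡m i≤n)))))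
                    (nat-+-* (n ∸ i) i lam)
      root : u - (nat n * lam - a) ≈ a - v
      root = begin
        u - (nat n * lam - a) ≈⟨ +-congˡ (-‿cong (+-congʳ split)) ⟩
        u - ((v + u) - a)     ≈⟨ +-congˡ (-‿cong ([x+y]-z≈y-[z-x] v u a)) ⟩
        u - (u - (a - v))     ≈⟨ x-[x-y]≈y u (a - v) ⟩
        a - v                 ∎

    binomialWeight : Carrier → ℕ → ℕ → Carrier
    binomialWeight a n i = nat (n C i) * dfall lam a (n ∸ i)

    -- The degenerate binomial theorem (y + a)_{n,λ} = Σ_i C(n,i) (a)_{n-i,λ} (y)_{i,λ}.
    dfall-binomial : ∀ a n → mulRoots (unit 0) (λ t → nat t * lam - a) n
                             ≋ combination n (binomialWeight a n) (S lam)
    dfall-binomial a zero    l = sym (trans (*-congʳ (trans (*-identityʳ _) (+-identityʳ 1#)))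
                                            (trans (*-identityˡ _) (S-zero l)))
    dfall-binomial a (suc n) l = begin
      mulRoot (B n) (mulRoots (unit 0) B n) l
        ≈⟨ mulRoot-cong refl (dfall-binomial a n) l ⟩
      mulRoot (B n) (combination n (binomialWeight a n) (S lam)) l
        ≈⟨ mulRoot-combination n (binomialWeight a n) (S lam) (B n) l ⟩
      sumTo n (λ i → binomialWeight a n i * mulRoot (B n) (S lam i) l)
        ≈⟨ sumTo-cong≤ n step ⟩
      sumTo n (λ i → nat (n C i) * f (suc i) + nat (n C i) * f i)
        ≈⟨ sumTo-distrib-+ n _ _ ⟩
      sumTo n (λ i → nat (n C i) * f (suc i)) + sumTo n (λ i → nat (n C i) * f i)
        ≈⟨ sumTo-pascal n f ⟨
      sumTo (suc n) (λ i → nat (suc n C i) * f i)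
        ≈⟨ sumTo-cong (suc n) (λ i → *-assoc _ _ _) ⟨
      combination (suc n) (binomialWeight a (suc n)) (S lam) l
        ∎
      where
      B : ℕ → Carrier
      B t = nat t * lam - a
      f : ℕ → Carrier
      f i = dfall lam a (suc n ∸ i) * S lam i l
      step : ∀ {i} → i ≤ n → binomialWeight a n i * mulRoot (B n) (S lam i) l
                             ≈ nat (n C i) * f (suc i) + nat (n C i) * f i
      step {i} i≤n = begin
        binomialWeight a n i * mulRoot (B n) (S lam i) l
          ≈⟨ *-congˡ (mulRoot-S a i≤n l) ⟩
        nat (n C i) * dfall lam a (n ∸ i) * (S lam (suc i) l + (a - nat (n ∸ i) * lam) * S lam i l)
          ≈⟨ solve 5 (λ C A S′ r S → C :* A :* (S′ :+ r :* S) := C :* (A :* S′) :+ C :* (A :* r :* S))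
                     refl _ _ _ _ _ ⟩
        nat (n C i) * f (suc i) + nat (n C i) * (dfall lam a (suc (n ∸ i)) * S lam i l)
          ≡⟨ ≡.cong (λ k → nat (n C i) * f (suc i) + nat (n C i) * (dfall lam a k * S lam i l))
                    (≡.sym (ℕ.+-∸-assoc 1 i≤n)) ⟩
        nat (n C i) * f (suc i) + nat (n C i) * f i
          ∎

    -- The coefficients of (y)_j (y - mλ)_{n,λ}.
    fallDfall : ℕ → ℕ → ℕ → Coeffs
    fallDfall m n j = mulRoots (unit j) (λ t → nat (m +ℕ t) * lam) n

    S-+-expansion : ∀ m n → S lam (m +ℕ n) ≋ combination m (S lam m) (fallDfall m n)
    S-+-expansion m n l = begin
      S lam (m +ℕ n) l
        ≈⟨ S-+ m n l ⟩
      mulRoots (S lam m) (λ t → nat (m +ℕ t) * lam) n l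
        ≈⟨ mulRoots-cong (combination-unit m S-vanishes) (λ _ → refl) n l ⟩
      mulRoots (combination m (S lam m) unit) (λ t → nat (m +ℕ t) * lam) n l
        ≈⟨ mulRoots-combination m (S lam m) unit _ n l ⟩
      combination m (S lam m) (fallDfall m n) l
        ∎

    fallDfall-shifted : ∀ m n j → Shifted j (fallDfall m n j)
                                    (combination n (binomialWeight (nat j - nat m * lam) n) (S lam))
    fallDfall-shifted m n j = Shifted-congʳ
      (λ l → trans (mulRoots-cong (λ _ → refl) root n l) (dfall-binomial (nat j - nat m * lam) n l))
      (mulRoots-shifted _ n (unit-shifted j))
      where
      root : ∀ t → nat (m +ℕ t) * lam - nat j ≈ nat t * lam - (nat j - nat m * lam)
      root t = trans (+-congʳ (nat-+-* m t lam)) ([x+y]-z≈y-[z-x] (nat m * lam) (nat t * lam) (nat j))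

    eval-S : ∀ {k N} x → k ≤ N → eval N (S lam k) x ≈ φ lam k x
    eval-S x = eval-vanishingʳ x S-vanishes

    eval-fallDfall : ∀ {m j} n x → j ≤ m →
                     eval (m +ℕ n) (fallDfall m n j) x
                     ≈ pow x j * sumTo n (λ k → binomialWeight (nat j - nat m * lam) n k * φ lam k x)
    eval-fallDfall {m} {j} n x j≤m = begin
      eval (m +ℕ n) (fallDfall m n j) x
        ≡⟨ ≡.cong (λ N → eval N (fallDfall m n j) x) m+n≡j+M ⟩
      eval (j +ℕ M) (fallDfall m n j) x
        ≈⟨ eval-shifted M x (fallDfall-shifted m n j) ⟩
      pow x j * eval M (combination n w (S lam)) x
        ≈⟨ *-congˡ (eval-combination M n w (S lam) x) ⟩
      pow x j * sumTo n (λ k → w k * eval M (S lam k) x)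
        ≈⟨ *-congˡ (sumTo-cong≤ n (λ k≤n → *-congˡ (eval-S x (ℕ.≤-trans k≤n n≤M)))) ⟩
      pow x j * sumTo n (λ k → w k * φ lam k x)
        ∎
      where
      M : ℕ
      M = (m ∸ j) +ℕ n
      w : ℕ → Carrier
      w = binomialWeight (nat j - nat m * lam) n
      n≤M : n ≤ M
      n≤M = ℕ.m≤n+m n (m ∸ j)
      m+n≡j+M : m +ℕ n ≡.≡ j +ℕ M
      m+n≡j+M = ≡.trans (≡.cong (_+ℕ n) (≡.sym (ℕ.m+[n∸m]≡n j≤m))) (ℕ.+-assoc j (m ∸ j) n)

    φ-+ : ∀ m n x → φ lam (m +ℕ n) x ≈ rhs lam m n x
    φ-+ m n x = begin
      φ lam (m +ℕ n) x
        ≈⟨ eval-cong (m +ℕ n) x (S-+-expansion m n) ⟩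
      eval (m +ℕ n) (combination m (S lam m) (fallDfall m n)) x
        ≈⟨ eval-combination (m +ℕ n) m (S lam m) (fallDfall m n) x ⟩
      sumTo m (λ j → S lam m j * eval (m +ℕ n) (fallDfall m n j) x)
        ≈⟨ sumTo-cong≤ m (λ j≤m → *-congˡ (eval-fallDfall n x j≤m)) ⟩
      sumTo m (λ j → S lam m j * (pow x j * sumTo n (λ k → w j k * φ lam k x)))
        ≈⟨ sumTo-cong m (λ j → trans (*-congˡ (*-distribˡ-sumTo n (pow x j) _))
                                     (*-distribˡ-sumTo n _ _)) ⟩
      sumTo m (λ j → sumTo n (λ k → S lam m j * (pow x j * (w j k * φ lam k x))))
        ≈⟨ sumTo-cong m (λ j → sumTo-cong n (λ k →
             solve 5 (λ s p C A f → s :* (p :* (C :* A :* f)) := C :* s :* A :* p :* f) refl _ _ _ _ _)) ⟩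
      rhs lam m n x
        ∎
      where
      w : ℕ → ℕ → Carrier
      w j = binomialWeight (nat j - nat m * lam) n

theorem2p2 : ∀ {c ℓ} (R : CommutativeRing c ℓ) →
    let open CommutativeRing R
        open Degenerate R
    in (lam : Carrier) → ¬ (lam ≈ 0#) → (m n : ℕ) →
       ((x : Carrier) → φ lam (m +ℕ n) x ≈ rhs lam m n x)
       × (φ lam (m +ℕ n) 1# ≈ rhs lam m n 1#)
theorem2p2 R lam _ m n = φ-+ R lam m n , φ-+ R lam m n (CommutativeRing.1# R)
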